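{- Let $n\ge q\ge s\ge 2$ be integers. If $f(n-1,q,s)=|\mathcal B(n-1,q,s)|$ and $f(n-1,q-s,s)=|\mathcal B(n-1,q-s,s)|$, then $f(n,q,s)=|\mathcal B(n,q,s)|$.
   Context: A family $\mathcal F\subset 2^{[N]}$ has property $D(s,q)$ if $|F_1\cup\dots\cup F_s|>q$ for all $F_1,\dots,F_s\in\mathcal F$ that are pairwise disjoint ($F_a\cap F_b=\emptyset$ for $a\ne b$; members may coincide only if empty). $f(N,q,s):=\max\{|\mathcal F|:\mathcal F\subset 2^{[N]}\text{ has property }D(s,q)\}$. For an integer $q\ge 0$ write uniquely $q=s(m+1)-l$ with integers $m\ge 0$ and $1\le l\le s$, and set $\mathcal B(N,q,s):=\{F\subset[N]: |F|+|F\cap[l-1]|\ge m+1\}$, where $[l-1]=\{1,\dots,l-1\}$. -}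

module Defs where

open import Data.Nat using (ℕ; zero; suc; _+_; _*_; _∸_; _≤_; _<_; _<ᵇ_; NonZero)
open import Data.Nat.Properties using (_≤?_)
open import Data.Nat.DivMod using (_/_; _%_)
open import Data.Bool using (Bool; true; false)
open import Data.Fin using (Fin; toℕ)
open import Data.Fin.Subset using (Subset; ⋃; _∩_; ∣_∣; ⊥)
open import Data.Vec using (Vec; []; _∷_; tabulate)
open import Data.List using (List; []; _∷_; _++_; map; length; filter)
import Data.List as L
open import Data.List.Membership.Propositional using (_∈_)
open import Data.List.Relation.Unary.Unique.Propositional using (Unique)
open import Relation.Binary.PropositionalEquality using (_≡_; _≢_)

record Family (N : ℕ) : Set where
  field
    members : List (Subset N)
    unique  : Unique members

card : ∀ {N} → Family N → ℕ
card 𝓕 = length (Family.members 𝓕)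

Disjoint : ∀ {N} → Subset N → Subset N → Set
Disjoint F G = F ∩ G ≡ ⊥

HasD : ∀ {N} → (s q : ℕ) → Family N → Set
HasD {N} s q 𝓕 =
  (F : Fin s → Subset N) →
  (∀ a → F a ∈ Family.members 𝓕) →
  (∀ a b → a ≢ b → Disjoint (F a) (F b)) →
  q < ∣ ⋃ (L.tabulate F) ∣

fIs : ℕ → ℕ → ℕ → ℕ → Set
fIs N q s k =
  (Σ (Family N) λ 𝓕 → HasD s q 𝓕 × card 𝓕 ≡ k) ×
  (∀ (𝓕 : Family N) → HasD s q 𝓕 → card 𝓕 ≤ k)
  where open import Data.Product using (Σ; _×_)

-- The unique decomposition q = s(m+1) - l with m ≥ 0, 1 ≤ l ≤ s (for s ≥ 1):
-- m = q / s and l = s - (q mod s).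
decM : (q s : ℕ) → .{{NonZero s}} → ℕ
decM q s = q / s

decL : (q s : ℕ) → .{{NonZero s}} → ℕ
decL q s = s ∸ (q % s)

allSubsets : (N : ℕ) → List (Subset N)
allSubsets zero    = [] ∷ []
allSubsets (suc N) = map (true ∷_) (allSubsets N) ++ map (false ∷_) (allSubsets N)

-- [k] = {1,…,k} ∩ [N], i.e. the first k points of Fin N
initSeg : (N k : ℕ) → Subset N
initSeg N k = tabulate (λ i → toℕ i <ᵇ k)

𝓑 : (N q s : ℕ) → .{{NonZero s}} → List (Subset N)
𝓑 N q s = filter (λ F → suc (decM q s) ≤? ∣ F ∣ + ∣ F ∩ initSeg N (decL q s ∸ 1) ∣) (allSubsets N)

∣𝓑∣ : (N q s : ℕ) → .{{NonZero s}} → ℕ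
∣𝓑∣ N q s = length (𝓑 N q s)

-- Lower bound: for pairwise disjoint F₁, …, Fₛ the weights |Fᵢ| + |Fᵢ ∩ [l-1]| add up to at
-- most |⋃ Fᵢ| + (l - 1), while on 𝓑(N,q,s) every weight is at least m + 1; hence
-- |⋃ Fᵢ| ≥ s(m + 1) - (l - 1) = q + 1. Splitting by a point outside [l-1] gives
-- |𝓑(n,q,s)| = |𝓑(n-1,q,s)| + |𝓑(n-1,q-s,s)|, as q - s = s·m - l has the same l and m one less.
--
-- Upper bound, with the new point as coordinate 0: shifting 𝓕 from 0 to every other point
-- keeps |𝓕| and property D(s,q) and makes 𝓕 stable (F ∪ {0} ∈ 𝓕 and y ∉ F imply F ∪ {y} ∈ 𝓕).
-- The members avoiding 0 then form a D(s,q) family on n - 1 points, and the members containing 0,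
-- with 0 removed, a D(s,q-s) family, since by stability s disjoint ones with small union could be
-- completed to s disjoint members of 𝓕 with union of size at most q.

module Submission where

open import Defs
open import Data.Bool using (Bool; true; false; _∧_; _∨_; if_then_else_)
import Data.Bool as Bool
open import Data.Bool.Properties using (T-≡; ¬-not; ∨-identityʳ; ∨-zeroʳ)
open import Data.Empty using (⊥-elim)
open import Data.Fin using (Fin; zero; suc; inject≤)
import Data.Fin.Properties as Fin
open import Data.Fin.Properties using (any?; inject≤-injective)
open import Data.Fin.Subset using (Subset; inside; outside; ∁; ⋃; _∩_; _∪_; ∣_∣; ⊥; _∈_; _∉_; _⊆_; ⁅_⁆)
open import Data.Fin.Subset.Properties
  using (∣⊥∣≡0; ∣⁅x⁆∣≡1; ∣∁p∣≡n∸∣p∣; p⊆q⇒∣p∣≤∣q∣; ∩-comm; ∩-distribˡ-∪; ∩-zeroʳ; ∪-identityʳ;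
         p∩q⊆p; p∩q⊆q; p⊆p∪q; q⊆p∪q; x∈p∩q⁺; x∈p∩q⁻; x∈p∪q⁻; x∈⁅y⁆⇒x≡y; x∈∁p⇒x∉p; ∉⊥; Empty-unique)
import Data.List as L
open import Data.List using (List; []; _∷_; _++_; map; filter; length)
open import Data.List.Membership.Propositional using () renaming (_∈_ to _∈ˡ_)
open import Data.List.Membership.Propositional.Properties using (∈-map⁻; ∈-filter⁻; ∈-allFin)
open import Data.List.Properties using (filter-++; length-++)
open import Data.List.Relation.Unary.All using ([])
open import Data.List.Relation.Unary.All.Properties.Core using (All¬⇒¬Any)
open import Data.List.Relation.Unary.AllPairs using ([]; _∷_)
open import Data.List.Relation.Unary.Any using (here; there)
open import Data.List.Relation.Unary.Unique.Propositional using (Unique)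
import Data.List.Relation.Unary.Unique.Propositional.Properties as Unique
open import Data.Nat using (ℕ; zero; suc; pred; _+_; _*_; _∸_; _≤_; _<_; _≤ᵇ_; z≤n; s≤s; NonZero)
open import Data.Nat.DivMod using (_%_; m/n≡1+[m∸n]/n; m≤n⇒[n∸m]%m≡n%m; m≡m%n+[m/n]*n; m%n<n)
open import Data.Nat.Properties hiding (_≟_)
open import Data.Nat.Tactic.RingSolver using (solve-∀)
open import Data.Product using (_×_; _,_; proj₁; proj₂)
open import Data.Sum using (_⊎_; inj₁; inj₂)
open import Data.Vec using (Vec; []; _∷_; insertAt; lookup; zipWith; _[_]≔_)
import Data.Vec as Vec
open import Data.Vec.Properties
  using (≡-dec; lookup-zipWith; lookup-replicate; lookup∘update; lookup⇒[]=; []≔-lookup; []≔-idempotent; insertAt-lookup)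
open import Function using (_∘_; id; case_of_)
open import Function.Bundles using (Equivalence)
open import Relation.Binary.PropositionalEquality
open import Relation.Nullary using (Dec; does; yes; no; contradiction)
open import Relation.Nullary.Decidable using (T?)
open import Relation.Unary using (Decidable)

open import Algebra.Properties.CommutativeMonoid.Sum +-0-commutativeMonoid using (sum; ∑-distrib-+)
open import Algebra.Properties.CommutativeSemigroup +-commutativeSemigroup using (interchange)

private variable
  n s : ℕ

-- Subsets of [n] and disjoint families

sum-mono-≤ : {f g : Fin s → ℕ} → (∀ a → f a ≤ g a) → sum f ≤ sum g
sum-mono-≤ {zero}  f≤g = ≤-refl
sum-mono-≤ {suc s} f≤g = +-mono-≤ (f≤g zero) (sum-mono-≤ (f≤g ∘ suc))

sum-const : ∀ s c → sum {s} (λ _ → c) ≡ s * c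
sum-const zero    c = refl
sum-const (suc s) c = cong (c +_) (sum-const s c)

∣p∪q∣+∣p∩q∣≡∣p∣+∣q∣ : (p q : Subset n) → ∣ p ∪ q ∣ + ∣ p ∩ q ∣ ≡ ∣ p ∣ + ∣ q ∣
∣p∪q∣+∣p∩q∣≡∣p∣+∣q∣ []            []            = refl
∣p∪q∣+∣p∩q∣≡∣p∣+∣q∣ (inside  ∷ p) (inside  ∷ q) = cong suc (begin
  ∣ p ∪ q ∣ + suc ∣ p ∩ q ∣ ≡⟨ +-suc _ _ ⟩
  suc (∣ p ∪ q ∣ + ∣ p ∩ q ∣) ≡⟨ cong suc (∣p∪q∣+∣p∩q∣≡∣p∣+∣q∣ p q) ⟩
  suc (∣ p ∣ + ∣ q ∣)         ≡⟨ +-suc _ _ ⟨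
  ∣ p ∣ + suc ∣ q ∣           ∎)
  where open ≡-Reasoning
∣p∪q∣+∣p∩q∣≡∣p∣+∣q∣ (inside  ∷ p) (outside ∷ q) = cong suc (∣p∪q∣+∣p∩q∣≡∣p∣+∣q∣ p q)
∣p∪q∣+∣p∩q∣≡∣p∣+∣q∣ (outside ∷ p) (inside  ∷ q) =
  trans (cong suc (∣p∪q∣+∣p∩q∣≡∣p∣+∣q∣ p q)) (sym (+-suc ∣ p ∣ ∣ q ∣))
∣p∪q∣+∣p∩q∣≡∣p∣+∣q∣ (outside ∷ p) (outside ∷ q) = ∣p∪q∣+∣p∩q∣≡∣p∣+∣q∣ p q

∣p∪q∣≤∣p∣+∣q∣ : (p q : Subset n) → ∣ p ∪ q ∣ ≤ ∣ p ∣ + ∣ q ∣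
∣p∪q∣≤∣p∣+∣q∣ p q = ≤-trans (m≤m+n _ _) (≤-reflexive (∣p∪q∣+∣p∩q∣≡∣p∣+∣q∣ p q))

disjoint⁺ : {p q : Subset n} → (∀ {x} → x ∈ p → x ∉ q) → Disjoint p q
disjoint⁺ {p = p} {q} p∉q = Empty-unique λ (x , x∈p∩q) →
  let x∈p , x∈q = x∈p∩q⁻ p q x∈p∩q in p∉q x∈p x∈q

disjoint⁻ : {p q : Subset n} {x : Fin n} → Disjoint p q → x ∈ p → x ∉ q
disjoint⁻ p∩q≡⊥ x∈p x∈q = ∉⊥ (subst (_ ∈_) p∩q≡⊥ (x∈p∩q⁺ (x∈p , x∈q)))

disjoint-sym : {p q : Subset n} → Disjoint p q → Disjoint q p
disjoint-sym {p = p} {q} p⊥q = trans (∩-comm q p) p⊥q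

PairwiseDisjoint : (Fin s → Subset n) → Set
PairwiseDisjoint F = ∀ a b → a ≢ b → Disjoint (F a) (F b)

⊆⋃ : (F : Fin s → Subset n) (a : Fin s) → F a ⊆ ⋃ (L.tabulate F)
⊆⋃ F zero    = p⊆p∪q _
⊆⋃ F (suc a) = q⊆p∪q (F zero) _ ∘ ⊆⋃ (F ∘ suc) a

⋃⊆ : {q : Subset n} (F : Fin s → Subset n) → (∀ a → F a ⊆ q) → ⋃ (L.tabulate F) ⊆ q
⋃⊆ {s = zero}      F F⊆q x∈⊥ = ⊥-elim (∉⊥ x∈⊥)
⋃⊆ {s = suc s} {q} F F⊆q x∈⋃ with x∈p∪q⁻ (F zero) _ x∈⋃
... | inj₁ x∈F₀ = F⊆q zero x∈F₀
... | inj₂ x∈U  = ⋃⊆ (F ∘ suc) (F⊆q ∘ suc) x∈U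

∣⋃∣≤∑∣∣ : (F : Fin s → Subset n) → ∣ ⋃ (L.tabulate F) ∣ ≤ sum (∣_∣ ∘ F)
∣⋃∣≤∑∣∣ {zero}  {n} F = ≤-reflexive (∣⊥∣≡0 n)
∣⋃∣≤∑∣∣ {suc s}     F =
  ≤-trans (∣p∪q∣≤∣p∣+∣q∣ (F zero) _) (+-monoʳ-≤ ∣ F zero ∣ (∣⋃∣≤∑∣∣ (F ∘ suc)))

disjoint-⋃ : {p : Subset n} (F : Fin s → Subset n) → (∀ a → Disjoint p (F a)) →
             Disjoint p (⋃ (L.tabulate F))
disjoint-⋃ {s = zero}  {p = p} F _  = ∩-zeroʳ p
disjoint-⋃ {s = suc s} {p = p} F p⊥F = begin
  p ∩ (F zero ∪ ⋃ (L.tabulate (F ∘ suc)))            ≡⟨ ∩-distribˡ-∪ p _ _ ⟩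
  (p ∩ F zero) ∪ (p ∩ ⋃ (L.tabulate (F ∘ suc)))      ≡⟨ cong₂ _∪_ (p⊥F zero) (disjoint-⋃ (F ∘ suc) (p⊥F ∘ suc)) ⟩
  ⊥ ∪ ⊥                                                ≡⟨ ∪-identityʳ ⊥ ⟩
  ⊥                                                    ∎
  where open ≡-Reasoning

∣⋃∣≡∑∣∣ : (F : Fin s → Subset n) → PairwiseDisjoint F → ∣ ⋃ (L.tabulate F) ∣ ≡ sum (∣_∣ ∘ F)
∣⋃∣≡∑∣∣ {zero}  {n} F _  = ∣⊥∣≡0 n
∣⋃∣≡∑∣∣ {suc s} {n} F pd = begin
  ∣ F zero ∪ U ∣                          ≡⟨ +-identityʳ _ ⟨
  ∣ F zero ∪ U ∣ + 0                      ≡⟨ cong (∣ F zero ∪ U ∣ +_) (trans (cong ∣_∣ F₀∩U≡⊥) (∣⊥∣≡0 n)) ⟨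
  ∣ F zero ∪ U ∣ + ∣ F zero ∩ U ∣         ≡⟨ ∣p∪q∣+∣p∩q∣≡∣p∣+∣q∣ (F zero) U ⟩
  ∣ F zero ∣ + ∣ U ∣                      ≡⟨ cong (∣ F zero ∣ +_) (∣⋃∣≡∑∣∣ (F ∘ suc) pd∘suc) ⟩
  ∣ F zero ∣ + sum (∣_∣ ∘ F ∘ suc)        ∎
  where
  open ≡-Reasoning
  U = ⋃ (L.tabulate (F ∘ suc))
  F₀∩U≡⊥ : F zero ∩ U ≡ ⊥
  F₀∩U≡⊥ = disjoint-⋃ (F ∘ suc) λ a → pd zero (suc a) λ ()
  pd∘suc : PairwiseDisjoint (F ∘ suc)
  pd∘suc a b a≢b = pd (suc a) (suc b) (a≢b ∘ Fin.suc-injective)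

∑∣∣+∣∩∣≤∣⋃∣+∣∣ : (F : Fin s → Subset n) (I : Subset n) → PairwiseDisjoint F →
                sum (λ a → ∣ F a ∣ + ∣ F a ∩ I ∣) ≤ ∣ ⋃ (L.tabulate F) ∣ + ∣ I ∣
∑∣∣+∣∩∣≤∣⋃∣+∣∣ F I pd = begin
  sum (λ a → ∣ F a ∣ + ∣ F a ∩ I ∣)                 ≡⟨ ∑-distrib-+ (∣_∣ ∘ F) (λ a → ∣ F a ∩ I ∣) ⟩
  sum (∣_∣ ∘ F) + sum (λ a → ∣ F a ∩ I ∣)           ≡⟨ cong₂ _+_ (∣⋃∣≡∑∣∣ F pd) (∣⋃∣≡∑∣∣ F∩I pd∩I) ⟨
  ∣ ⋃ (L.tabulate F) ∣ + ∣ ⋃ (L.tabulate F∩I) ∣     ≤⟨ +-monoʳ-≤ _ (p⊆q⇒∣p∣≤∣q∣ (⋃⊆ F∩I λ a → p∩q⊆q (F a) I)) ⟩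
  ∣ ⋃ (L.tabulate F) ∣ + ∣ I ∣                      ∎
  where
  open ≤-Reasoning
  F∩I = λ a → F a ∩ I
  pd∩I : PairwiseDisjoint F∩I
  pd∩I a b a≢b = disjoint⁺ λ x∈a x∈b →
    disjoint⁻ (pd a b a≢b) (p∩q⊆p (F a) I x∈a) (p∩q⊆p (F b) I x∈b)

∈∪⁅⁆⁻ : {p : Subset n} {x y : Fin n} → x ∈ p ∪ ⁅ y ⁆ → x ∈ p ⊎ x ≡ y
∈∪⁅⁆⁻ {p = p} {y = y} x∈ with x∈p∪q⁻ p ⁅ y ⁆ x∈
... | inj₁ x∈p  = inj₁ x∈p
... | inj₂ x∈⁅y⁆ = inj₂ (x∈⁅y⁆⇒x≡y y x∈⁅y⁆)

disjoint-∪⁅⁆ʳ : {p q : Subset n} {y : Fin n} → Disjoint p q → y ∉ p → Disjoint p (q ∪ ⁅ y ⁆)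
disjoint-∪⁅⁆ʳ p⊥q y∉p = disjoint⁺ λ x∈p x∈q′ → case ∈∪⁅⁆⁻ x∈q′ of λ where
  (inj₁ x∈q)  → disjoint⁻ p⊥q x∈p x∈q
  (inj₂ refl) → y∉p x∈p

disjoint-∪⁅⁆ : {p q : Subset n} {x y : Fin n} → Disjoint p q → x ∉ q → y ∉ p → x ≢ y →
               Disjoint (p ∪ ⁅ x ⁆) (q ∪ ⁅ y ⁆)
disjoint-∪⁅⁆ p⊥q x∉q y∉p x≢y = disjoint⁺ λ z∈p′ z∈q′ → case ∈∪⁅⁆⁻ z∈p′ , ∈∪⁅⁆⁻ z∈q′ of λ where
  (inj₁ z∈p  , inj₁ z∈q)  → disjoint⁻ p⊥q z∈p z∈q
  (inj₁ z∈p  , inj₂ refl) → y∉p z∈p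
  (inj₂ refl , inj₁ z∈q)  → x∉q z∈q
  (inj₂ refl , inj₂ z≡y)  → x≢y z≡y

disjoint-lookup : {p q : Subset n} {x : Fin n} → Disjoint p q → lookup p x ≡ inside → lookup q x ≡ outside
disjoint-lookup {p = p} {q} {x} p∩q≡⊥ pₓ≡inside = begin
  lookup q x                 ≡⟨ cong (_∧ lookup q x) pₓ≡inside ⟨
  lookup p x ∧ lookup q x    ≡⟨ lookup-zipWith _∧_ x p q ⟨
  lookup (p ∩ q) x           ≡⟨ cong (λ r → lookup r x) p∩q≡⊥ ⟩
  lookup ⊥ x                 ≡⟨ lookup-replicate x outside ⟩
  outside                    ∎
  where open ≡-Reasoning

∪⁅⁆≡[]≔inside : (G : Subset n) (y : Fin n) → G ∪ ⁅ y ⁆ ≡ G [ y ]≔ inside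
∪⁅⁆≡[]≔inside (b ∷ G) zero    = cong₂ _∷_ (∨-zeroʳ b) (∪-identityʳ G)
∪⁅⁆≡[]≔inside (b ∷ G) (suc y) = cong₂ _∷_ (∨-identityʳ b) (∪⁅⁆≡[]≔inside G y)

∉⇒lookup≡outside : {G : Subset n} {y : Fin n} → y ∉ G → lookup G y ≡ outside
∉⇒lookup≡outside {G = G} {y} y∉G with lookup G y in eq
... | inside  = ⊥-elim (y∉G (lookup⇒[]= y G eq))
... | outside = refl

lookup-∪⁅⁆ : (G : Subset n) (y : Fin n) → lookup (G ∪ ⁅ y ⁆) y ≡ inside
lookup-∪⁅⁆ G y = trans (cong (λ H → lookup H y) (∪⁅⁆≡[]≔inside G y)) (lookup∘update y G inside)

enumerate : (p : Subset n) → Fin ∣ p ∣ → Fin n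
enumerate (inside  ∷ p) zero    = zero
enumerate (inside  ∷ p) (suc i) = suc (enumerate p i)
enumerate (outside ∷ p) i       = suc (enumerate p i)

enumerate-∈ : (p : Subset n) (i : Fin ∣ p ∣) → enumerate p i ∈ p
enumerate-∈ (inside  ∷ p) zero    = Vec.here
enumerate-∈ (inside  ∷ p) (suc i) = Vec.there (enumerate-∈ p i)
enumerate-∈ (outside ∷ p) i       = Vec.there (enumerate-∈ p i)

enumerate-injective : (p : Subset n) (i j : Fin ∣ p ∣) → enumerate p i ≡ enumerate p j → i ≡ j
enumerate-injective (inside  ∷ p) zero    zero    _  = refl
enumerate-injective (inside  ∷ p) (suc i) (suc j) eq = cong suc (enumerate-injective p i j (Fin.suc-injective eq))
enumerate-injective (outside ∷ p) i       j       eq = enumerate-injective p i j (Fin.suc-injective eq)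

module _ (U : Subset n) {k : ℕ} (k≤ : k ≤ n ∸ ∣ U ∣) where

  private
    k≤∣∁U∣ : k ≤ ∣ ∁ U ∣
    k≤∣∁U∣ = ≤-trans k≤ (≤-reflexive (sym (∣∁p∣≡n∸∣p∣ U)))

  pointsOutside : Fin k → Fin n
  pointsOutside a = enumerate (∁ U) (inject≤ a k≤∣∁U∣)

  pointsOutside-∉ : ∀ a → pointsOutside a ∉ U
  pointsOutside-∉ a = x∈∁p⇒x∉p (enumerate-∈ (∁ U) (inject≤ a k≤∣∁U∣))

  pointsOutside-injective : ∀ a b → pointsOutside a ≡ pointsOutside b → a ≡ b
  pointsOutside-injective a b eq =
    inject≤-injective k≤∣∁U∣ k≤∣∁U∣ a b (enumerate-injective (∁ U) _ _ eq)

-- Families as characteristic functions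

-- A family of subsets of [n] is represented by its characteristic function P, of size count n P.
count : ∀ n → (Subset n → Bool) → ℕ
count zero    P = if P [] then 1 else 0
count (suc n) P = count n (P ∘ (inside ∷_)) + count n (P ∘ (outside ∷_))

count-cong : ∀ n {P Q : Subset n → Bool} → (∀ F → P F ≡ Q F) → count n P ≡ count n Q
count-cong zero    P≡Q = cong (if_then 1 else 0) (P≡Q [])
count-cong (suc n) P≡Q = cong₂ _+_ (count-cong n (P≡Q ∘ (inside ∷_))) (count-cong n (P≡Q ∘ (outside ∷_)))

count-false : ∀ n → count n (λ _ → false) ≡ 0
count-false zero    = refl
count-false (suc n) = cong₂ _+_ (count-false n) (count-false n)

count-∨+count-∧ : ∀ n (P Q : Subset n → Bool) →
                  count n (λ F → P F ∨ Q F) + count n (λ F → P F ∧ Q F) ≡ count n P + count n Q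
count-∨+count-∧ zero P Q with P [] | Q []
... | true  | true  = refl
... | true  | false = refl
... | false | true  = refl
... | false | false = refl
count-∨+count-∧ (suc n) P Q = begin
  (∨₁ + ∨₀) + (∧₁ + ∧₀) ≡⟨ interchange ∨₁ ∨₀ ∧₁ ∧₀ ⟩
  (∨₁ + ∧₁) + (∨₀ + ∧₀) ≡⟨ cong₂ _+_ (count-∨+count-∧ n (P ∘ (inside ∷_)) (Q ∘ (inside ∷_)))
                                     (count-∨+count-∧ n (P ∘ (outside ∷_)) (Q ∘ (outside ∷_))) ⟩
  (P₁ + Q₁) + (P₀ + Q₀) ≡⟨ interchange P₁ Q₁ P₀ Q₀ ⟩
  (P₁ + P₀) + (Q₁ + Q₀) ∎
  where
  open ≡-Reasoning
  ∨₁ = count n (λ F → P (inside ∷ F) ∨ Q (inside ∷ F))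
  ∨₀ = count n (λ F → P (outside ∷ F) ∨ Q (outside ∷ F))
  ∧₁ = count n (λ F → P (inside ∷ F) ∧ Q (inside ∷ F))
  ∧₀ = count n (λ F → P (outside ∷ F) ∧ Q (outside ∷ F))
  P₁ = count n (P ∘ (inside ∷_))
  P₀ = count n (P ∘ (outside ∷_))
  Q₁ = count n (Q ∘ (inside ∷_))
  Q₀ = count n (Q ∘ (outside ∷_))

_≟_ : (F G : Subset n) → Dec (F ≡ G)
_≟_ = ≡-dec Bool._≟_

count-≟ : ∀ n (G : Subset n) → count n (λ F → does (F ≟ G)) ≡ 1
count-≟ zero    []            = refl
count-≟ (suc n) (inside  ∷ G) = cong₂ _+_ (count-≟ n G) (count-false n)
count-≟ (suc n) (outside ∷ G) = cong₂ _+_ (count-false n) (count-≟ n G)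

count-insertAt : ∀ n (y : Fin (suc n)) (P : Subset (suc n) → Bool) →
  count (suc n) P ≡ count n (λ K → P (insertAt K y inside)) + count n (λ K → P (insertAt K y outside))
count-insertAt n       zero    P = refl
count-insertAt (suc n) (suc y) P = begin
  count (suc n) (P ∘ (inside ∷_)) + count (suc n) (P ∘ (outside ∷_))
    ≡⟨ cong₂ _+_ (count-insertAt n y (P ∘ (inside ∷_))) (count-insertAt n y (P ∘ (outside ∷_))) ⟩
  (in₁ + in₀) + (out₁ + out₀) ≡⟨ interchange in₁ in₀ out₁ out₀ ⟩
  (in₁ + out₁) + (in₀ + out₀) ∎
  where
  open ≡-Reasoning
  in₁ = count n (λ K → P (inside ∷ insertAt K y inside))
  in₀ = count n (λ K → P (inside ∷ insertAt K y outside))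
  out₁ = count n (λ K → P (outside ∷ insertAt K y inside))
  out₀ = count n (λ K → P (outside ∷ insertAt K y outside))

module _ {n : ℕ} where
  open import Data.List.Membership.DecPropositional (_≟_ {n}) public using (_∈?_)

count-∈? : ∀ {n} (xs : List (Subset n)) → Unique xs → length xs ≡ count n (λ F → does (F ∈? xs))
count-∈? {n} []       _            = sym (count-false n)
count-∈? {n} (x ∷ xs) (x∉xs ∷ !xs) = begin
  suc (length xs)                                   ≡⟨ cong₂ _+_ (sym (count-≟ n x)) (count-∈? xs !xs) ⟩
  count n (does ∘ (_≟ x)) + count n (does ∘ (_∈? xs)) ≡⟨ count-∨+count-∧ n (does ∘ (_≟ x)) (does ∘ (_∈? xs)) ⟨
  count n (does ∘ (_∈? (x ∷ xs))) + count n both      ≡⟨ cong (count n (does ∘ (_∈? (x ∷ xs))) +_) (trans (count-cong n never) (count-false n)) ⟩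
  count n (does ∘ (_∈? (x ∷ xs))) + 0                 ≡⟨ +-identityʳ _ ⟩
  count n (does ∘ (_∈? (x ∷ xs)))                     ∎
  where
  open ≡-Reasoning
  both : Subset n → Bool
  both F = does (F ≟ x) ∧ does (F ∈? xs)
  never : ∀ F → both F ≡ false
  never F with F ≟ x | F ∈? xs
  ... | yes refl | yes x∈xs = ⊥-elim (All¬⇒¬Any x∉xs x∈xs)
  ... | yes _    | no  _    = refl
  ... | no  _    | _        = refl

allSubsets-unique : ∀ n → Unique (allSubsets n)
allSubsets-unique zero    = [] ∷ []
allSubsets-unique (suc n) =
  Unique.++⁺ (Unique.map⁺ (cong Vec.tail) (allSubsets-unique n))
             (Unique.map⁺ (cong Vec.tail) (allSubsets-unique n))
             λ (∈ins , ∈outs) → case ∈-map⁻ (inside ∷_) ∈ins , ∈-map⁻ (outside ∷_) ∈outs of λ where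
               ((_ , _ , refl) , (_ , _ , ()))

length-filter-map : {A B : Set} {P : B → Set} (P? : Decidable P) (f : A → B) (xs : List A) →
                    length (filter P? (map f xs)) ≡ length (filter (P? ∘ f) xs)
length-filter-map P? f []       = refl
length-filter-map P? f (x ∷ xs) with does (P? (f x))
... | true  = cong suc (length-filter-map P? f xs)
... | false = length-filter-map P? f xs

length-filter-allSubsets : ∀ n {P : Subset n → Set} (P? : Decidable P) →
                           length (filter P? (allSubsets n)) ≡ count n (does ∘ P?)
length-filter-allSubsets zero    P? with does (P? [])
... | true  = refl
... | false = refl
length-filter-allSubsets (suc n) P? = begin
  length (filter P? (map (inside ∷_) (allSubsets n) ++ map (outside ∷_) (allSubsets n)))
    ≡⟨ cong length (filter-++ P? (map (inside ∷_) (allSubsets n)) _) ⟩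
  length (filter P? (map (inside ∷_) (allSubsets n)) ++ filter P? (map (outside ∷_) (allSubsets n)))
    ≡⟨ length-++ (filter P? (map (inside ∷_) (allSubsets n))) ⟩
  length (filter P? (map (inside ∷_) (allSubsets n))) + length (filter P? (map (outside ∷_) (allSubsets n)))
    ≡⟨ cong₂ _+_ (length-filter-map P? (inside ∷_) (allSubsets n)) (length-filter-map P? (outside ∷_) (allSubsets n)) ⟩
  length (filter (P? ∘ (inside ∷_)) (allSubsets n)) + length (filter (P? ∘ (outside ∷_)) (allSubsets n))
    ≡⟨ cong₂ _+_ (length-filter-allSubsets n (P? ∘ (inside ∷_))) (length-filter-allSubsets n (P? ∘ (outside ∷_))) ⟩
  count (suc n) (does ∘ P?) ∎
  where open ≡-Reasoning

HasDᵇ : ∀ {N} → ℕ → ℕ → (Subset N → Bool) → Set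
HasDᵇ {N} s q P = (F : Fin s → Subset N) → (∀ a → P (F a) ≡ true) → PairwiseDisjoint F →
                  q < ∣ ⋃ (L.tabulate F) ∣

familyOf : ∀ N → (Subset N → Bool) → Family N
familyOf N P = record
  { members = filter (T? ∘ P) (allSubsets N)
  ; unique  = Unique.filter⁺ (T? ∘ P) (allSubsets-unique N)
  }

card-familyOf : ∀ N (P : Subset N → Bool) → card (familyOf N P) ≡ count N P
card-familyOf N P = length-filter-allSubsets N (T? ∘ P)

HasDᵇ⇒HasD-familyOf : ∀ {N s q} (P : Subset N → Bool) → HasDᵇ s q P → HasD s q (familyOf N P)
HasDᵇ⇒HasD-familyOf {N} P hasD F F∈ =
  hasD F λ a → Equivalence.to T-≡ (proj₂ (∈-filter⁻ (T? ∘ P) {xs = allSubsets N} (F∈ a)))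

fIs⇒count≤ : ∀ {N s q k} → fIs N q s k → (P : Subset N → Bool) → HasDᵇ s q P → count N P ≤ k
fIs⇒count≤ {N} (_ , maximal) P hasD =
  subst (_≤ _) (card-familyOf N P) (maximal (familyOf N P) (HasDᵇ⇒HasD-familyOf P hasD))

χ : ∀ {N} → Family N → Subset N → Bool
χ 𝓕 F = does (F ∈? Family.members 𝓕)

card≡countχ : ∀ {N} (𝓕 : Family N) → card 𝓕 ≡ count N (χ 𝓕)
card≡countχ 𝓕 = count-∈? (Family.members 𝓕) (Family.unique 𝓕)

HasD⇒HasDᵇ : ∀ {N s q} (𝓕 : Family N) → HasD s q 𝓕 → HasDᵇ s q (χ 𝓕)
HasD⇒HasDᵇ 𝓕 hasD F F∈ = hasD F λ a → witness (F a ∈? Family.members 𝓕) (F∈ a)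
  where
  witness : {A : Set} (a? : Dec A) → does a? ≡ true → A
  witness (yes a) _ = a

-- Shifting from the new point 0

[]≔-zipWith : {A B C : Set} (f : A → B → C) (xs : Vec A n) (ys : Vec B n) (i : Fin n) (x : A) (y : B) →
              zipWith f xs ys [ i ]≔ f x y ≡ zipWith f (xs [ i ]≔ x) (ys [ i ]≔ y)
[]≔-zipWith f (_ ∷ xs) (_ ∷ ys) zero    x y = refl
[]≔-zipWith f (u ∷ xs) (v ∷ ys) (suc i) x y = cong (f u v ∷_) ([]≔-zipWith f xs ys i x y)

insertAt-[]≔ : {A : Set} (xs : Vec A n) (i : Fin (suc n)) (x y : A) → insertAt xs i x [ i ]≔ y ≡ insertAt xs i y
insertAt-[]≔ xs       zero    x y = refl
insertAt-[]≔ (u ∷ xs) (suc i) x y = cong (u ∷_) (insertAt-[]≔ xs i x y)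

swap : ∀ {N} → Fin N → Subset (suc N) → Subset (suc N)
swap y (b ∷ G) = lookup G y ∷ (G [ y ]≔ b)

swap-id : ∀ {N} (y : Fin N) b (G : Subset N) → lookup G y ≡ b → swap y (b ∷ G) ≡ b ∷ G
swap-id y b G refl = cong (lookup G y ∷_) ([]≔-lookup G y)

swap-insertAt : ∀ {N} (y : Fin (suc N)) b c (K : Subset N) → swap y (b ∷ insertAt K y c) ≡ c ∷ insertAt K y b
swap-insertAt y b c K = cong₂ _∷_ (insertAt-lookup K y c) (insertAt-[]≔ K y c b)

swap-zipWith : ∀ {N} (f : Bool → Bool → Bool) (y : Fin N) (v w : Subset (suc N)) →
               swap y (zipWith f v w) ≡ zipWith f (swap y v) (swap y w)
swap-zipWith f y (b ∷ G) (c ∷ H) = cong₂ _∷_ (lookup-zipWith f y G H) ([]≔-zipWith f G H y b c)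

swap-⊥ : ∀ {N} (y : Fin N) → swap y ⊥ ≡ ⊥
swap-⊥ y = swap-id y outside ⊥ (lookup-replicate y outside)

swap-⋃ : ∀ {N} (y : Fin N) (F : Fin s → Subset (suc N)) →
         ⋃ (L.tabulate (swap y ∘ F)) ≡ swap y (⋃ (L.tabulate F))
swap-⋃ {s = zero}  y F = sym (swap-⊥ y)
swap-⋃ {s = suc s} y F = trans (cong (swap y (F zero) ∪_) (swap-⋃ y (F ∘ suc)))
                               (sym (swap-zipWith _∨_ y (F zero) _))

swap-PairwiseDisjoint : ∀ {N} (y : Fin N) (F : Fin s → Subset (suc N)) →
                        PairwiseDisjoint F → PairwiseDisjoint (swap y ∘ F)
swap-PairwiseDisjoint y F pd a b a≢b =
  trans (sym (swap-zipWith _∧_ y (F a) (F b))) (trans (cong (swap y) (pd a b a≢b)) (swap-⊥ y))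

∣∷∣-cong : ∀ b {G H : Subset n} → ∣ G ∣ ≡ ∣ H ∣ → ∣ b ∷ G ∣ ≡ ∣ b ∷ H ∣
∣∷∣-cong inside  = cong suc
∣∷∣-cong outside = id

∣∷∷∣-comm : ∀ b c (G : Subset n) → ∣ b ∷ c ∷ G ∣ ≡ ∣ c ∷ b ∷ G ∣
∣∷∷∣-comm inside  inside  G = refl
∣∷∷∣-comm inside  outside G = refl
∣∷∷∣-comm outside inside  G = refl
∣∷∷∣-comm outside outside G = refl

∣swap∣ : ∀ {N} (y : Fin N) (v : Subset (suc N)) → ∣ swap y v ∣ ≡ ∣ v ∣
∣swap∣ zero    (b ∷ c ∷ G) = ∣∷∷∣-comm c b G
∣swap∣ (suc y) (b ∷ c ∷ G) = begin
  ∣ lookup G y ∷ c ∷ (G [ y ]≔ b) ∣ ≡⟨ ∣∷∷∣-comm (lookup G y) c (G [ y ]≔ b) ⟩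
  ∣ c ∷ lookup G y ∷ (G [ y ]≔ b) ∣ ≡⟨ ∣∷∣-cong c {swap y (b ∷ G)} {b ∷ G} (∣swap∣ y (b ∷ G)) ⟩
  ∣ c ∷ b ∷ G ∣                     ≡⟨ ∣∷∷∣-comm c b G ⟩
  ∣ b ∷ c ∷ G ∣                     ∎
  where open ≡-Reasoning

-- The down-shift from the new point 0 to the old point y (coordinate suc y): a member
-- containing 0 but not y is replaced by its swap unless the swap is already a member.
shift : ∀ {N} → Fin N → (Subset (suc N) → Bool) → Subset (suc N) → Bool
shift y P (inside  ∷ G) = if lookup G y then P (inside ∷ G) else P (inside ∷ G) ∧ P (swap y (inside ∷ G))
shift y P (outside ∷ G) = if lookup G y then P (swap y (outside ∷ G)) ∨ P (outside ∷ G) else P (outside ∷ G)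

-- Split both halves at y: only the blocks {0} ∪ K and {y} ∪ K change, into a ∧ b and a ∨ b.
count-shift : ∀ {N} (y : Fin N) (P : Subset (suc N) → Bool) → count (suc N) (shift y P) ≡ count (suc N) P
count-shift {suc M} y P = begin
  count (suc M) (shift y P ∘ (inside ∷_)) + count (suc M) (shift y P ∘ (outside ∷_))
    ≡⟨ cong₂ _+_ (count-insertAt M y (shift y P ∘ (inside ∷_))) (count-insertAt M y (shift y P ∘ (outside ∷_))) ⟩
  (count M (shift y P ∘ in∷ inside) + count M (shift y P ∘ in∷ outside))
    + (count M (shift y P ∘ out∷ inside) + count M (shift y P ∘ out∷ outside))
    ≡⟨ cong₂ _+_ (cong₂ _+_ (count-cong M keep₁) (count-cong M meet)) (cong₂ _+_ (count-cong M join) (count-cong M keep₀)) ⟩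
  (#₁ + #a∧b) + (#a∨b + #₀)   ≡⟨ regroup #₁ #a∧b #a∨b #₀ ⟩
  #₁ + ((#a∨b + #a∧b) + #₀)   ≡⟨ cong (λ m → #₁ + (m + #₀)) (count-∨+count-∧ M a b) ⟩
  #₁ + ((#a + #b) + #₀)       ≡⟨ ungroup #₁ #a #b #₀ ⟩
  (#₁ + #a) + (#b + #₀)
    ≡⟨ cong₂ _+_ (count-insertAt M y (P ∘ (inside ∷_))) (count-insertAt M y (P ∘ (outside ∷_))) ⟨
  count (suc M) (P ∘ (inside ∷_)) + count (suc M) (P ∘ (outside ∷_)) ∎
  where
  open ≡-Reasoning
  in∷ out∷ : Bool → Subset M → Subset (suc (suc M))
  in∷  c K = inside  ∷ insertAt K y c
  out∷ c K = outside ∷ insertAt K y c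
  a b : Subset M → Bool
  a = P ∘ in∷ outside
  b = P ∘ out∷ inside
  #₁ = count M (P ∘ in∷ inside)
  #₀ = count M (P ∘ out∷ outside)
  #a = count M a
  #b = count M b
  #a∧b = count M (λ K → a K ∧ b K)
  #a∨b = count M (λ K → a K ∨ b K)
  keep₁ : ∀ K → shift y P (in∷ inside K) ≡ P (in∷ inside K)
  keep₁ K rewrite insertAt-lookup K y inside = refl
  meet : ∀ K → shift y P (in∷ outside K) ≡ a K ∧ b K
  meet K rewrite swap-insertAt y inside outside K | insertAt-lookup K y outside = refl
  join : ∀ K → shift y P (out∷ inside K) ≡ a K ∨ b K
  join K rewrite swap-insertAt y outside inside K | insertAt-lookup K y inside = refl
  keep₀ : ∀ K → shift y P (out∷ outside K) ≡ P (out∷ outside K)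
  keep₀ K rewrite insertAt-lookup K y outside = refl
  regroup : ∀ t x y o → (t + x) + (y + o) ≡ t + ((y + x) + o)
  regroup = solve-∀
  ungroup : ∀ t x y o → t + ((x + y) + o) ≡ (t + x) + (y + o)
  ungroup = solve-∀

shift-new : ∀ {N} (y : Fin N) (P : Subset (suc N) → Bool) (v : Subset (suc N)) →
            shift y P v ≡ true → P v ≡ false → lookup v (suc y) ≡ inside × P (swap y v) ≡ true
shift-new y P (inside  ∷ G) S P≡f with lookup G y | P (inside ∷ G)
shift-new y P (inside  ∷ G) S  () | true  | true
shift-new y P (inside  ∷ G) () _  | true  | false
shift-new y P (inside  ∷ G) S  () | false | true
shift-new y P (inside  ∷ G) () _  | false | false
shift-new y P (outside ∷ G) S P≡f with lookup G y | P (outside ∷ G)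
shift-new y P (outside ∷ G) S  _  | true  | false = refl , trans (sym (∨-identityʳ _)) S
shift-new y P (outside ∷ G) S  () | _     | true
shift-new y P (outside ∷ G) () _  | false | false

shift-∌ : ∀ {N} (y : Fin N) (P : Subset (suc N) → Bool) (v : Subset (suc N)) →
          lookup v (suc y) ≡ outside → shift y P v ≡ true → P (swap y v) ≡ true
shift-∌ y P (inside  ∷ G) l S with lookup G y | P (inside ∷ G)
shift-∌ y P (inside  ∷ G) () S | true  | _
shift-∌ y P (inside  ∷ G) l  S | false | true = S
shift-∌ y P (inside  ∷ G) l () | false | false
shift-∌ y P (outside ∷ G) l S rewrite swap-id y outside G l | l = S

-- A member of the shifted family that was not in P contains y+1, so no other member
-- does; swapping the whole family therefore lands in P.
shift-HasDᵇ : ∀ {N s q} (y : Fin N) (P : Subset (suc N) → Bool) → HasDᵇ s q P → HasDᵇ s q (shift y P)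
shift-HasDᵇ {q = q} y P hasD F F∈ pd with any? (λ a → P (F a) Bool.≟ false)
... | no  ∄new          = hasD F (λ a → ¬-not (∄new ∘ (a ,_))) pd
... | yes (i , Pᵢ≡false) =
  subst (q <_) (trans (cong ∣_∣ (swap-⋃ y F)) (∣swap∣ y (⋃ (L.tabulate F))))
        (hasD (swap y ∘ F) swap∈ (swap-PairwiseDisjoint y F pd))
  where
  new = shift-new y P (F i) (F∈ i) Pᵢ≡false
  swap∈ : ∀ a → P (swap y (F a)) ≡ true
  swap∈ a with a Fin.≟ i
  ... | yes refl = proj₂ new
  ... | no  a≢i  = shift-∌ y P (F a) (disjoint-lookup (pd i a (a≢i ∘ sym)) (proj₁ new)) (F∈ a)

swap-∪⁅⁆ : ∀ {N} {G : Subset N} {y : Fin N} → y ∉ G → swap y (outside ∷ (G ∪ ⁅ y ⁆)) ≡ inside ∷ G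
swap-∪⁅⁆ {G = G} {y} y∉G rewrite ∪⁅⁆≡[]≔inside G y = cong₂ _∷_ (lookup∘update y G inside) (begin
  (G [ y ]≔ inside) [ y ]≔ outside   ≡⟨ []≔-idempotent G y ⟩
  G [ y ]≔ outside                   ≡⟨ cong (G [ y ]≔_) (∉⇒lookup≡outside y∉G) ⟨
  G [ y ]≔ lookup G y                ≡⟨ []≔-lookup G y ⟩
  G                                  ∎)
  where open ≡-Reasoning

shift-inside : ∀ {N} (y : Fin N) (P : Subset (suc N) → Bool) (G : Subset N) →
               shift y P (inside ∷ G) ≡ true → P (inside ∷ G) ≡ true
shift-inside y P G S with lookup G y | P (inside ∷ G)
shift-inside y P G S  | _     | true  = refl
shift-inside y P G () | true  | false
shift-inside y P G () | false | false

shift-outside : ∀ {N} (y : Fin N) (P : Subset (suc N) → Bool) (G : Subset N) →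
                P (outside ∷ G) ≡ true → shift y P (outside ∷ G) ≡ true
shift-outside y P G P≡t with lookup G y | P (outside ∷ G)
shift-outside y P G P≡t | true  | true = ∨-zeroʳ _
shift-outside y P G P≡t | false | true = refl

shift-outside-∋ : ∀ {N} (y : Fin N) (P : Subset (suc N) → Bool) (G : Subset N) → lookup G y ≡ inside →
                  shift y P (outside ∷ G) ≡ P (swap y (outside ∷ G)) ∨ P (outside ∷ G)
shift-outside-∋ y P G l rewrite l = refl

Stable : ∀ {N} → Fin N → (Subset (suc N) → Bool) → Set
Stable {N} y R = (G : Subset N) → y ∉ G → R (inside ∷ G) ≡ true → R (outside ∷ (G ∪ ⁅ y ⁆)) ≡ true

shift-Stable : ∀ {N} (y : Fin N) (P : Subset (suc N) → Bool) → Stable y (shift y P)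
shift-Stable y P G y∉G S = begin
  shift y P (outside ∷ G′)                         ≡⟨ shift-outside-∋ y P G′ (lookup-∪⁅⁆ G y) ⟩
  P (swap y (outside ∷ G′)) ∨ P (outside ∷ G′)     ≡⟨ cong (λ v → P v ∨ P (outside ∷ G′)) (swap-∪⁅⁆ y∉G) ⟩
  P (inside ∷ G) ∨ P (outside ∷ G′)                ≡⟨ cong (_∨ P (outside ∷ G′)) (shift-inside y P G S) ⟩
  true                                             ∎
  where
  open ≡-Reasoning
  G′ = G ∪ ⁅ y ⁆

shift-preserves-Stable : ∀ {N} {y : Fin N} (z : Fin N) {R : Subset (suc N) → Bool} →
                         Stable y R → Stable y (shift z R)
shift-preserves-Stable z {R} stable G y∉G S =
  shift-outside z R (G ∪ ⁅ _ ⁆) (stable G y∉G (shift-inside z R G S))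

shiftAll : ∀ {N} → List (Fin N) → (Subset (suc N) → Bool) → Subset (suc N) → Bool
shiftAll []       P = P
shiftAll (y ∷ ys) P = shiftAll ys (shift y P)

count-shiftAll : ∀ {N} (ys : List (Fin N)) (P : Subset (suc N) → Bool) →
                 count (suc N) (shiftAll ys P) ≡ count (suc N) P
count-shiftAll []       P = refl
count-shiftAll (y ∷ ys) P = trans (count-shiftAll ys (shift y P)) (count-shift y P)

shiftAll-HasDᵇ : ∀ {N s q} (ys : List (Fin N)) (P : Subset (suc N) → Bool) →
                 HasDᵇ s q P → HasDᵇ s q (shiftAll ys P)
shiftAll-HasDᵇ []       P hasD = hasD
shiftAll-HasDᵇ (y ∷ ys) P hasD = shiftAll-HasDᵇ ys (shift y P) (shift-HasDᵇ y P hasD)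

shiftAll-preserves-Stable : ∀ {N} {y : Fin N} (ys : List (Fin N)) {R : Subset (suc N) → Bool} →
                            Stable y R → Stable y (shiftAll ys R)
shiftAll-preserves-Stable []       stable = stable
shiftAll-preserves-Stable (z ∷ ys) {R} stable = shiftAll-preserves-Stable ys (shift-preserves-Stable z {R} stable)

shiftAll-Stable : ∀ {N} {y : Fin N} (ys : List (Fin N)) (P : Subset (suc N) → Bool) →
                  y ∈ˡ ys → Stable y (shiftAll ys P)
shiftAll-Stable (y ∷ ys) P (here refl) = shiftAll-preserves-Stable ys (shift-Stable y P)
shiftAll-Stable (z ∷ ys) P (there y∈ys) = shiftAll-Stable ys (shift z P) y∈ys

-- Splitting a stable family at the new point

⋃-outside∷ : (G : Fin s → Subset n) → ⋃ (L.tabulate ((outside ∷_) ∘ G)) ≡ outside ∷ ⋃ (L.tabulate G)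
⋃-outside∷ {s = zero}  G = refl
⋃-outside∷ {s = suc s} G = cong (zipWith _∨_ (outside ∷ G zero)) (⋃-outside∷ (G ∘ suc))

HasDᵇ-outside : ∀ {N s q} (R : Subset (suc N) → Bool) → HasDᵇ s q R → HasDᵇ s q (R ∘ (outside ∷_))
HasDᵇ-outside {q = q} R hasD G G∈ pd = subst (λ v → q < ∣ v ∣) (⋃-outside∷ G)
  (hasD ((outside ∷_) ∘ G) G∈ λ a b a≢b → cong (outside ∷_) (pd a b a≢b))

extend : ∀ {N} (G : Fin (suc s) → Subset N) (x : Fin s → Fin N) → Fin (suc s) → Subset (suc N)
extend G x zero    = inside  ∷ G zero
extend G x (suc a) = outside ∷ (G (suc a) ∪ ⁅ x a ⁆)

extend-PairwiseDisjoint : ∀ {N} (G : Fin (suc s) → Subset N) (x : Fin s → Fin N) →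
  PairwiseDisjoint G → (∀ a b → x a ≡ x b → a ≡ b) → (∀ a c → x a ∉ G c) →
  PairwiseDisjoint (extend G x)
extend-PairwiseDisjoint G x pd x-inj x∉G = λ where
  zero    zero    0≢0 → ⊥-elim (0≢0 refl)
  zero    (suc b) _   → cong (outside ∷_) (disjoint-∪⁅⁆ʳ (pd zero (suc b) λ ()) (x∉G b zero))
  (suc a) zero    _   → cong (outside ∷_) (disjoint-sym (disjoint-∪⁅⁆ʳ (pd zero (suc a) λ ()) (x∉G a zero)))
  (suc a) (suc b) a≢b → cong (outside ∷_) (disjoint-∪⁅⁆ (pd (suc a) (suc b) a≢b) (x∉G a (suc b)) (x∉G b (suc a))
                                                         (a≢b ∘ cong suc ∘ x-inj a b))

∣extend∣≤ : ∀ {N} (G : Fin (suc s) → Subset N) (x : Fin s → Fin N) a → ∣ extend G x a ∣ ≤ suc ∣ G a ∣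
∣extend∣≤ G x zero    = ≤-refl
∣extend∣≤ G x (suc a) = begin
  ∣ G (suc a) ∪ ⁅ x a ⁆ ∣       ≤⟨ ∣p∪q∣≤∣p∣+∣q∣ (G (suc a)) ⁅ x a ⁆ ⟩
  ∣ G (suc a) ∣ + ∣ ⁅ x a ⁆ ∣   ≡⟨ cong (∣ G (suc a) ∣ +_) (∣⁅x⁆∣≡1 (x a)) ⟩
  ∣ G (suc a) ∣ + 1             ≡⟨ +-comm _ 1 ⟩
  suc ∣ G (suc a) ∣             ∎
  where open ≤-Reasoning

-- If G₀, …, Gₛ were too small, the s points missed by their union (there are enough,
-- as q ≤ N + 1) would extend them to s + 1 disjoint members of R with union of size ≤ q.
HasDᵇ-inside : ∀ {N s q} (R : Subset (suc N) → Bool) → suc s ≤ q → q ≤ suc N → (∀ y → Stable y R) →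
               HasDᵇ (suc s) q R → HasDᵇ (suc s) (q ∸ suc s) (R ∘ (inside ∷_))
HasDᵇ-inside {N} {s} {q} R s<q q≤N+1 stable hasD G G∈ pd with ∣ ⋃ (L.tabulate G) ∣ ≤? q ∸ suc s
... | no  ∣U∣≰ = ≰⇒> ∣U∣≰
... | yes ∣U∣≤ = contradiction (hasD F F∈ pdF) (≤⇒≯ ∣⋃F∣≤q)
  where
  U = ⋃ (L.tabulate G)
  s≤N∸∣U∣ : s ≤ N ∸ ∣ U ∣
  s≤N∸∣U∣ = m+n≤o⇒m≤o∸n s (≤-pred (begin
    suc s + ∣ U ∣             ≤⟨ +-monoʳ-≤ (suc s) ∣U∣≤ ⟩
    suc s + (q ∸ suc s)       ≡⟨ m+[n∸m]≡n s<q ⟩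
    q                         ≤⟨ q≤N+1 ⟩
    suc N                     ∎))
    where open ≤-Reasoning
  x = pointsOutside U s≤N∸∣U∣
  x∉G : ∀ a c → x a ∉ G c
  x∉G a c = pointsOutside-∉ U s≤N∸∣U∣ a ∘ ⊆⋃ G c
  F = extend G x
  F∈ : ∀ a → R (F a) ≡ true
  F∈ zero    = G∈ zero
  F∈ (suc a) = stable (x a) (G (suc a)) (x∉G a (suc a)) (G∈ (suc a))
  pdF : PairwiseDisjoint F
  pdF = extend-PairwiseDisjoint G x pd (pointsOutside-injective U s≤N∸∣U∣) x∉G
  ∣⋃F∣≤q : ∣ ⋃ (L.tabulate F) ∣ ≤ q
  ∣⋃F∣≤q = begin
    ∣ ⋃ (L.tabulate F) ∣               ≤⟨ ∣⋃∣≤∑∣∣ F ⟩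
    sum (∣_∣ ∘ F)                      ≤⟨ sum-mono-≤ (∣extend∣≤ G x) ⟩
    sum (λ a → 1 + ∣ G a ∣)            ≡⟨ ∑-distrib-+ (λ _ → 1) (∣_∣ ∘ G) ⟩
    sum {suc s} (λ _ → 1) + sum (∣_∣ ∘ G) ≡⟨ cong₂ _+_ (sym (trans (sum-const (suc s) 1) (*-identityʳ (suc s)))) (∣⋃∣≡∑∣∣ G pd) ⟨
    suc s + ∣ U ∣                      ≤⟨ +-monoʳ-≤ (suc s) ∣U∣≤ ⟩
    suc s + (q ∸ suc s)                ≡⟨ m+[n∸m]≡n s<q ⟩
    q                                  ∎
    where open ≤-Reasoning

count≤-suc : ∀ {N s q a b} → suc s ≤ q → q ≤ suc N →
              (∀ P → HasDᵇ (suc s) q P → count N P ≤ a) →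
              (∀ P → HasDᵇ (suc s) (q ∸ suc s) P → count N P ≤ b) →
              ∀ P → HasDᵇ (suc s) q P → count (suc N) P ≤ b + a
count≤-suc {N} {s} {q} {a} {b} s<q q≤N+1 bound bound′ P hasD = begin
  count (suc N) P                                              ≡⟨ count-shiftAll ys P ⟨
  count N (R ∘ (inside ∷_)) + count N (R ∘ (outside ∷_))       ≤⟨ +-mono-≤ inside≤ outside≤ ⟩
  b + a                                                        ∎
  where
  open ≤-Reasoning
  ys = L.allFin N
  R = shiftAll ys P
  hasD-R : HasDᵇ (suc s) q R
  hasD-R = shiftAll-HasDᵇ ys P hasD
  inside≤ : count N (R ∘ (inside ∷_)) ≤ b
  inside≤ = bound′ (R ∘ (inside ∷_)) (HasDᵇ-inside R s<q q≤N+1 (λ y → shiftAll-Stable ys P (∈-allFin y)) hasD-R)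
  outside≤ : count N (R ∘ (outside ∷_)) ≤ a
  outside≤ = bound (R ∘ (outside ∷_)) (HasDᵇ-outside R hasD-R)

-- The families 𝓑(N,q,s)

∣initSeg∣≤ : ∀ N k → ∣ initSeg N k ∣ ≤ k
∣initSeg∣≤ zero    k       = z≤n
∣initSeg∣≤ (suc N) zero    = ∣initSeg∣≤ N zero
∣initSeg∣≤ (suc N) (suc k) = s≤s (∣initSeg∣≤ N k)

-- With r = q mod s and m = q / s: s(m+1) = (r + 1 + (s - r - 1)) + ms = (q + 1) + (l - 1).
s*[1+m]≡1+q+[l∸1] : ∀ q s .{{_ : NonZero s}} → s * suc (decM q s) ≡ suc q + (decL q s ∸ 1)
s*[1+m]≡1+q+[l∸1] q s = begin
  s * suc m                        ≡⟨ *-suc s m ⟩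
  s + s * m                        ≡⟨ cong₂ _+_ (m+[n∸m]≡n (m%n<n q s)) (*-comm m s) ⟨
  (suc r + (s ∸ suc r)) + m * s    ≡⟨ rearrange r (s ∸ suc r) (m * s) ⟩
  suc (r + m * s) + (s ∸ suc r)    ≡⟨ cong₂ (λ q′ d → suc q′ + d) (m≡m%n+[m/n]*n q s) s∸r∸1≡s∸[1+r] ⟨
  suc q + (s ∸ r ∸ 1)              ∎
  where
  open ≡-Reasoning
  m = decM q s
  r = q % s
  s∸r∸1≡s∸[1+r] : s ∸ r ∸ 1 ≡ s ∸ suc r
  s∸r∸1≡s∸[1+r] = trans (∸-+-assoc s r 1) (cong (s ∸_) (+-comm r 1))
  rearrange : ∀ a d e → (suc a + d) + e ≡ suc (a + e) + d
  rearrange = solve-∀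

𝓑-family : ∀ N q s .{{_ : NonZero s}} → Family N
𝓑-family N q s = record { members = 𝓑 N q s ; unique = Unique.filter⁺ _ (allSubsets-unique N) }

𝓑-HasD : ∀ N q s .{{_ : NonZero s}} → HasD s q (𝓑-family N q s)
𝓑-HasD N q s F F∈ pd = +-cancelʳ-≤ k (suc q) _ (begin
  suc q + k                                 ≡⟨ s*[1+m]≡1+q+[l∸1] q s ⟨
  s * suc m                                 ≡⟨ sum-const s (suc m) ⟨
  sum {s} (λ _ → suc m)                     ≤⟨ sum-mono-≤ heavy ⟩
  sum (λ a → ∣ F a ∣ + ∣ F a ∩ I ∣)          ≤⟨ ∑∣∣+∣∩∣≤∣⋃∣+∣∣ F I pd ⟩
  ∣ ⋃ (L.tabulate F) ∣ + ∣ I ∣               ≤⟨ +-monoʳ-≤ _ (∣initSeg∣≤ N k) ⟩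
  ∣ ⋃ (L.tabulate F) ∣ + k                   ∎)
  where
  open ≤-Reasoning
  m = decM q s
  k = decL q s ∸ 1
  I = initSeg N k
  heavy : ∀ a → suc m ≤ ∣ F a ∣ + ∣ F a ∩ I ∣
  heavy a = proj₂ (∈-filter⁻ (λ G → suc m ≤? ∣ G ∣ + ∣ G ∩ I ∣) {xs = allSubsets N} (F∈ a))

#weight≥ : (N k t : ℕ) → ℕ
#weight≥ N k t = count N (λ F → t ≤ᵇ ∣ F ∣ + ∣ F ∩ initSeg N k ∣)

≤ᵇ-suc : ∀ t m → (t ≤ᵇ suc m) ≡ (pred t ≤ᵇ m)
≤ᵇ-suc zero          m = refl
≤ᵇ-suc (suc zero)    m = refl
≤ᵇ-suc (suc (suc t)) m = refl

#weight≥-outside : ∀ N t → #weight≥ (suc N) 0 t ≡ #weight≥ N 0 (pred t) + #weight≥ N 0 t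
#weight≥-outside N t = cong (_+ #weight≥ N 0 t) (count-cong N λ G → ≤ᵇ-suc t _)

#weight≥-inside : ∀ N k t → #weight≥ (suc N) (suc k) t ≡ #weight≥ N k (pred (pred t)) + #weight≥ N k t
#weight≥-inside N k t = cong (_+ #weight≥ N k t) (count-cong N λ G → begin
  t ≤ᵇ suc ∣ G ∣ + suc ∣ G ∩ initSeg N k ∣          ≡⟨ ≤ᵇ-suc t _ ⟩
  pred t ≤ᵇ ∣ G ∣ + suc ∣ G ∩ initSeg N k ∣         ≡⟨ cong (pred t ≤ᵇ_) (+-suc ∣ G ∣ _) ⟩
  pred t ≤ᵇ suc (∣ G ∣ + ∣ G ∩ initSeg N k ∣)       ≡⟨ ≤ᵇ-suc (pred t) _ ⟩
  pred (pred t) ≤ᵇ ∣ G ∣ + ∣ G ∩ initSeg N k ∣      ∎)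
  where open ≡-Reasoning

-- A point outside [k] has weight 1.
#weight≥-suc : ∀ N k t → k ≤ N → #weight≥ (suc N) k t ≡ #weight≥ N k t + #weight≥ N k (pred t)
#weight≥-suc N       zero    t _ = trans (#weight≥-outside N t) (+-comm (#weight≥ N 0 (pred t)) _)
#weight≥-suc (suc N) (suc k) t (s≤s k≤N) = begin
  #weight≥ (suc (suc N)) (suc k) t                          ≡⟨ #weight≥-inside (suc N) k t ⟩
  #weight≥ (suc N) k (pred (pred t)) + #weight≥ (suc N) k t
    ≡⟨ cong₂ _+_ (#weight≥-suc N k (pred (pred t)) k≤N) (#weight≥-suc N k t k≤N) ⟩
  (w₂ + w₃) + (w₀ + w₁)                                     ≡⟨ interchange w₂ w₃ w₀ w₁ ⟩
  (w₂ + w₀) + (w₃ + w₁)                                     ≡⟨ cong₂ _+_ (#weight≥-inside N k t) (#weight≥-inside N k (pred t)) ⟨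
  #weight≥ (suc N) (suc k) t + #weight≥ (suc N) (suc k) (pred t) ∎
  where
  open ≡-Reasoning
  w₀ = #weight≥ N k t
  w₁ = #weight≥ N k (pred t)
  w₂ = #weight≥ N k (pred (pred t))
  w₃ = #weight≥ N k (pred (pred (pred t)))

∣𝓑∣≡#weight≥ : ∀ N q s .{{_ : NonZero s}} → ∣𝓑∣ N q s ≡ #weight≥ N (decL q s ∸ 1) (suc (decM q s))
∣𝓑∣≡#weight≥ N q s = length-filter-allSubsets N (λ F → suc (decM q s) ≤? ∣ F ∣ + ∣ F ∩ initSeg N (decL q s ∸ 1) ∣)

∣𝓑∣-∸≡#weight≥ : ∀ N q s .{{_ : NonZero s}} → s ≤ q → ∣𝓑∣ N (q ∸ s) s ≡ #weight≥ N (decL q s ∸ 1) (decM q s)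
∣𝓑∣-∸≡#weight≥ N q s s≤q = trans (∣𝓑∣≡#weight≥ N (q ∸ s) s)
  (cong₂ (λ l m → #weight≥ N (l ∸ 1) m) (cong (s ∸_) (m≤n⇒[n∸m]%m≡n%m s≤q)) (sym (m/n≡1+[m∸n]/n s≤q)))

∣𝓑∣-suc : ∀ N q s .{{_ : NonZero s}} → s ≤ q → q ≤ suc N →
          ∣𝓑∣ (suc N) q s ≡ ∣𝓑∣ N (q ∸ s) s + ∣𝓑∣ N q s
∣𝓑∣-suc N q s s≤q q≤N+1 = begin
  ∣𝓑∣ (suc N) q s                         ≡⟨ ∣𝓑∣≡#weight≥ (suc N) q s ⟩
  #weight≥ (suc N) k t                    ≡⟨ #weight≥-suc N k t k≤N ⟩
  #weight≥ N k t + #weight≥ N k (pred t)  ≡⟨ +-comm (#weight≥ N k t) _ ⟩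
  #weight≥ N k (pred t) + #weight≥ N k t  ≡⟨ cong₂ _+_ (∣𝓑∣-∸≡#weight≥ N q s s≤q) (∣𝓑∣≡#weight≥ N q s) ⟨
  ∣𝓑∣ N (q ∸ s) s + ∣𝓑∣ N q s             ∎
  where
  open ≡-Reasoning
  k = decL q s ∸ 1
  t = suc (decM q s)
  k≤N : k ≤ N
  k≤N = ≤-trans (∸-monoˡ-≤ 1 (m∸n≤m s (q % s))) (≤-trans (∸-monoˡ-≤ 1 s≤q) (∸-monoˡ-≤ 1 q≤N+1))

proposition2 : (n q s : ℕ) → .{{_ : NonZero s}} → 2 ≤ s → s ≤ q → q ≤ n →
    fIs (n ∸ 1) q s (∣𝓑∣ (n ∸ 1) q s) →
    fIs (n ∸ 1) (q ∸ s) s (∣𝓑∣ (n ∸ 1) (q ∸ s) s) →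
    fIs n q s (∣𝓑∣ n q s)
proposition2 zero    q s       2≤s s≤q q≤0 _ _ with ≤-trans 2≤s (≤-trans s≤q q≤0)
... | ()
proposition2 (suc N) q (suc s) _   s≤q q≤n f[q] f[q∸s] =
  (𝓑-family (suc N) q (suc s) , 𝓑-HasD (suc N) q (suc s) , refl) , maximal
  where
  maximal : ∀ 𝓕 → HasD (suc s) q 𝓕 → card 𝓕 ≤ ∣𝓑∣ (suc N) q (suc s)
  maximal 𝓕 hasD = begin
    card 𝓕
      ≡⟨ card≡countχ 𝓕 ⟩
    count (suc N) (χ 𝓕)
      ≤⟨ count≤-suc s≤q q≤n (fIs⇒count≤ f[q]) (fIs⇒count≤ f[q∸s]) (χ 𝓕) (HasD⇒HasDᵇ 𝓕 hasD) ⟩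
    ∣𝓑∣ N (q ∸ suc s) (suc s) + ∣𝓑∣ N q (suc s)
      ≡⟨ ∣𝓑∣-suc N q (suc s) s≤q q≤n ⟨
    ∣𝓑∣ (suc N) q (suc s)
      ∎
    where open ≤-Reasoning
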